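{- Let $H$ be a graph, $u,v\in V(H)$ and $0\leq k\leq 3$ an integer. Let $H'$ be the graph obtained from $H$ by adding a new path $P$ between $u$ and $v$ whose $k$ internal vertices are new vertices of degree $2$ (when $k=0$, $P$ is just a new edge $uv$). Then for every $A\subseteq V(H)$, either $\rho^*_H(A)=\rho^*_{H'}(A)$, or $$\rho^*_{H'}(A)\leq \rho^*_H(A)\leq \rho^*_H(A\cup\{u,v\})\leq \rho^*_{H'}(A)+(7-2k).$$
   Context: For a graph $G$ and $A\subseteq V(G)$, $\rho_G(A)=9|A|-7|E(G[A])|$, where $G[A]$ is the induced subgraph, and $\rho^*_G(A)=\min\{\rho_G(S): A\subseteq S\subseteq V(G)\}$. -}

module Defs where

open import Data.Nat as ℕ using (ℕ; zero; suc)
open import Data.Integer as ℤ using (ℤ; +_; _-_; _*_; _⊓_)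
open import Data.Fin using (Fin; _↑ˡ_; _↑ʳ_)
open import Data.Fin.Subset using (Subset; _∈_; _⊆_; ⊤; ∣_∣)
open import Data.Fin.Subset.Properties using (_∈?_; _⊆?_)
open import Data.Bool using (true; false)
open import Data.List using (List; []; _∷_; [_]; _++_; map; filter; length; foldr; allFin)
open import Data.List.Relation.Unary.All using (All)
open import Data.List.Relation.Unary.Any using (Any)
open import Data.List.Relation.Unary.AllPairs using (AllPairs)
open import Data.Vec using (Vec; []; _∷_; replicate) renaming (_++_ to _++ᵛ_)
open import Data.Product using (Σ; _×_; _,_; proj₁; proj₂; swap)
open import Data.Sum using (_⊎_)
open import Relation.Nullary using (¬_)
open import Relation.Nullary.Decidable using (_×-dec_)
open import Relation.Binary.PropositionalEquality using (_≡_; _≢_)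

-- A finite graph on vertex set Fin n, given by a list of edges (unordered
-- pairs, each stored as one ordered pair).
record Graph : Set where
  constructor mkGraph
  field
    n     : ℕ
    edges : List (Fin n × Fin n)
open Graph public

SameEdge : ∀ {m} → (Fin m × Fin m) → (Fin m × Fin m) → Set
SameEdge e f = (e ≡ f) ⊎ (swap e ≡ f)

Simple : Graph → Set
Simple G = All (λ e → proj₁ e ≢ proj₂ e) (edges G)
         × AllPairs (λ e f → ¬ SameEdge e f) (edges G)

Adjacent : (G : Graph) → Fin (n G) → Fin (n G) → Set
Adjacent G u v = Any (SameEdge (u , v)) (edges G)

eCount : (G : Graph) → Subset (n G) → ℕ
eCount G A = length (filter (λ e → (proj₁ e ∈? A) ×-dec (proj₂ e ∈? A)) (edges G))

ρ : (G : Graph) → Subset (n G) → ℤ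
ρ G A = + 9 * + ∣ A ∣ - + 7 * + eCount G A

allSubsets : (m : ℕ) → List (Subset m)
allSubsets zero    = [ [] ]
allSubsets (suc m) = map (true ∷_) (allSubsets m) ++ map (false ∷_) (allSubsets m)

-- ρ*_G(A) = min { ρ_G(S) : A ⊆ S ⊆ V(G) }   (V(G) itself is such an S,
-- so using ρ_G(V(G)) as the starting value of the fold is harmless)
ρ* : (G : Graph) → Subset (n G) → ℤ
ρ* G A = foldr _⊓_ (ρ G ⊤) (map (ρ G) (filter (A ⊆?_) (allSubsets (n G))))

consecutive : ∀ {X : Set} → List X → List (X × X)
consecutive []           = []
consecutive (x ∷ [])     = []
consecutive (x ∷ y ∷ xs) = (x , y) ∷ consecutive (y ∷ xs)

-- H' : add a new u–v path whose k internal vertices are new vertices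
-- n, …, n+k-1 (old vertex i becomes i ↑ˡ k)
addPath : (H : Graph) → Fin (n H) → Fin (n H) → (k : ℕ) → Graph
addPath H u v k = mkGraph (n H ℕ.+ k)
  (map (λ e → (proj₁ e ↑ˡ k) , (proj₂ e ↑ˡ k)) (edges H)
   ++ consecutive ((u ↑ˡ k) ∷ (map (n H ↑ʳ_) (allFin k) ++ [ v ↑ˡ k ])))

liftSub : ∀ {m} (k : ℕ) → Subset m → Subset (m ℕ.+ k)
liftSub k A = A ++ᵛ replicate k false

module Submission where

open import Defs
open import Data.Bool using (Bool; true; false; _∧_)
open import Data.Nat as ℕ using (ℕ; zero; suc; _≤_; z≤n; s≤s) renaming (_*_ to _*ℕ_)
import Data.Nat.Properties as ℕ
open import Data.Integer as ℤ using (ℤ; +_; 0ℤ; _+_; _-_; _*_; _⊓_; +≤+) renaming (_≤_ to _≤ℤ_)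
import Data.Integer.Properties as ℤ
open import Data.Integer.Tactic.RingSolver using (solve-∀)
open import Data.Fin using (Fin; _↑ˡ_; _↑ʳ_)
open import Data.Fin.Subset using (Subset; _⊆_; _∈_; _∪_; ⁅_⁆; ⊤; ⊥; ∣_∣)
import Data.Fin.Subset.Properties as Subset
open import Data.List using (List; []; _∷_; [_]; _++_; map; filter; length; foldr; allFin; tabulate)
import Data.List.Properties as List
open import Data.List.Membership.Propositional using () renaming (_∈_ to _∈ᴸ_)
open import Data.List.Membership.Propositional.Properties
  using (∈-++⁺ˡ; ∈-++⁺ʳ; ∈-map⁺; ∈-map⁻; ∈-filter⁺; ∈-filter⁻; foldr-selective)
open import Data.List.Relation.Unary.Any using (here; there)
open import Data.Vec using (Vec; []; _∷_; lookup; toList; splitAt; here; there) renaming (_++_ to _++ᵛ_)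
import Data.Vec.Properties as Vec
open import Data.Product using (_×_; ∃; _,_; proj₁; proj₂; uncurry)
open import Data.Sum using (_⊎_; inj₁; inj₂)
open import Function using (_∘_; id)
open import Relation.Nullary using (¬_; does)
open import Relation.Unary using (Decidable)
open import Relation.Binary.PropositionalEquality
  using (_≡_; _≢_; refl; sym; trans; cong; cong₂; subst; subst₂; module ≡-Reasoning)

-- Write a vertex set of H′ as S ++ T, with S ⊆ V(H) and T a set of interior vertices of the new
-- path.  Then ρ_H′(S ++ T) = ρ_H(S) + 9|T| − 7p, where p counts the path edges inside S ++ T.
-- Charging each such edge to its end in T gives p ≤ |T|, hence ρ_H(S) ≤ ρ_H′(S ++ T), unless the
-- whole path lies in S ++ T; then u, v ∈ S and ρ_H(S) = ρ_H′(S ++ T) + 7 − 2k.  Applied to a set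
-- attaining ρ*_H′(A), this gives either ρ*_H(A) ≤ ρ*_H′(A), which forces equality since adding a
-- path can only lower ρ*, or ρ*_H(A ∪ {u, v}) ≤ ρ*_H′(A) + 7 − 2k.

allSubsets-complete : ∀ m (S : Subset m) → S ∈ᴸ allSubsets m
allSubsets-complete zero    []          = here refl
allSubsets-complete (suc m) (true ∷ S)  = ∈-++⁺ˡ (∈-map⁺ (true ∷_) (allSubsets-complete m S))
allSubsets-complete (suc m) (false ∷ S) =
  ∈-++⁺ʳ (map (true ∷_) (allSubsets m)) (∈-map⁺ (false ∷_) (allSubsets-complete m S))

foldr-⊓-≤ : ∀ b xs {y} → y ∈ᴸ xs → foldr _⊓_ b xs ≤ℤ y
foldr-⊓-≤ b (x ∷ xs) (here refl) = ℤ.i⊓j≤i x _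
foldr-⊓-≤ b (x ∷ xs) (there y∈xs) = ℤ.≤-trans (ℤ.i⊓j≤j x _) (foldr-⊓-≤ b xs y∈xs)

ρ*≤ρ : ∀ G {A S} → A ⊆ S → ρ* G A ≤ℤ ρ G S
ρ*≤ρ G {A} {S} A⊆S =
  foldr-⊓-≤ _ _ (∈-map⁺ (ρ G) (∈-filter⁺ (A Subset.⊆?_) (allSubsets-complete (n G) S) A⊆S))

ρ*-attained : ∀ G A → ∃ λ S → A ⊆ S × ρ* G A ≡ ρ G S
ρ*-attained G A with foldr-selective ℤ.⊓-sel (ρ G ⊤) (map (ρ G) (filter (A Subset.⊆?_) (allSubsets (n G))))
... | inj₁ ρ*≡ρ⊤ = ⊤ , Subset.⊆⊤ , ρ*≡ρ⊤
... | inj₂ ρ*∈ with ∈-map⁻ (ρ G) ρ*∈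
...   | S , S∈ , ρ*≡ρS = S , proj₂ (∈-filter⁻ (A Subset.⊆?_) {xs = allSubsets (n G)} S∈) , ρ*≡ρS

ρ*-mono : ∀ G {A B} → A ⊆ B → ρ* G A ≤ℤ ρ* G B
ρ*-mono G {A} {B} A⊆B with ρ*-attained G B
... | S , B⊆S , ρ*≡ρS = subst (ρ* G A ≤ℤ_) (sym ρ*≡ρS) (ρ*≤ρ G (Subset.⊆-trans A⊆B B⊆S))

++-mono-⊆ : ∀ {m k} {A S : Subset m} {B T : Subset k} → A ⊆ S → B ⊆ T → A ++ᵛ B ⊆ S ++ᵛ T
++-mono-⊆ {A = []}       {[]}    A⊆S B⊆T x∈B              = B⊆T x∈B
++-mono-⊆ {A = true ∷ A} {_ ∷ S} A⊆S B⊆T here with A⊆S here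
... | here = here
++-mono-⊆ {A = _ ∷ A}    {_ ∷ S} A⊆S B⊆T (there x∈A++B) = there (++-mono-⊆ (Subset.drop-∷-⊆ A⊆S) B⊆T x∈A++B)

++-⊆⁻ˡ : ∀ {m k} {A S : Subset m} {B T : Subset k} → A ++ᵛ B ⊆ S ++ᵛ T → A ⊆ S
++-⊆⁻ˡ {A = true ∷ A} {_ ∷ S} A++B⊆S++T here with A++B⊆S++T here
... | here = here
++-⊆⁻ˡ {A = _ ∷ A}    {_ ∷ S} A++B⊆S++T (there x∈A) = there (++-⊆⁻ˡ (Subset.drop-∷-⊆ A++B⊆S++T) x∈A)

∪-least : ∀ {m} {p q r : Subset m} → p ⊆ r → q ⊆ r → p ∪ q ⊆ r
∪-least {p = p} {q} p⊆r q⊆r x∈p∪q with Subset.x∈p∪q⁻ p q x∈p∪q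
... | inj₁ x∈p = p⊆r x∈p
... | inj₂ x∈q = q⊆r x∈q

x∈p⇒⁅x⁆⊆p : ∀ {m} {x : Fin m} {p : Subset m} → x ∈ p → ⁅ x ⁆ ⊆ p
x∈p⇒⁅x⁆⊆p {x = x} x∈p y∈⁅x⁆ = subst (_∈ _) (sym (Subset.x∈⁅y⁆⇒x≡y x y∈⁅x⁆)) x∈p

trues : List Bool → ℕ
trues []           = 0
trues (true ∷ bs)  = suc (trues bs)
trues (false ∷ bs) = trues bs

trues-++ : ∀ bs cs → trues (bs ++ cs) ≡ trues bs ℕ.+ trues cs
trues-++ []           cs = refl
trues-++ (true ∷ bs)  cs = cong suc (trues-++ bs cs)
trues-++ (false ∷ bs) cs = trues-++ bs cs

length-filter≡trues : ∀ {A : Set} {P : A → Set} (P? : Decidable P) xs →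
                      length (filter P? xs) ≡ trues (map (does ∘ P?) xs)
length-filter≡trues P? []       = refl
length-filter≡trues P? (x ∷ xs) with does (P? x)
... | true  = cong suc (length-filter≡trues P? xs)
... | false = length-filter≡trues P? xs

does-∈? : ∀ {m} (x : Fin m) (X : Subset m) → does (x Subset.∈? X) ≡ lookup X x
does-∈? Fin.zero    (true ∷ X)  = refl
does-∈? Fin.zero    (false ∷ X) = refl
does-∈? (Fin.suc x) (_ ∷ X)     = does-∈? x X

edgeIn : ∀ {m} → Subset m → Fin m × Fin m → Bool
edgeIn X e = lookup X (proj₁ e) ∧ lookup X (proj₂ e)

eCount≡trues : ∀ G X → eCount G X ≡ trues (map (edgeIn X) (edges G))
eCount≡trues G X = trans (length-filter≡trues _ (edges G))
  (cong trues (List.map-cong (λ e → cong₂ _∧_ (does-∈? (proj₁ e) X) (does-∈? (proj₂ e) X)) (edges G)))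

-- The number of edges with both ends in the set, of a path whose vertices carry these membership labels.
pathEdges : List Bool → ℕ
pathEdges bs = trues (map (uncurry _∧_) (consecutive bs))

pathLabels : ∀ {k} → Bool → Subset k → Bool → List Bool
pathLabels a T b = a ∷ toList T ++ [ b ]

map-edgeIn-consecutive : ∀ {m} (X : Subset m) vs →
  map (edgeIn X) (consecutive vs) ≡ map (uncurry _∧_) (consecutive (map (lookup X) vs))
map-edgeIn-consecutive X []           = refl
map-edgeIn-consecutive X (x ∷ [])     = refl
map-edgeIn-consecutive X (x ∷ y ∷ vs) = cong (_ ∷_) (map-edgeIn-consecutive X (y ∷ vs))

tabulate-lookup : ∀ {k} (T : Vec Bool k) → tabulate (lookup T) ≡ toList T
tabulate-lookup []      = refl
tabulate-lookup (t ∷ T) = cong (t ∷_) (tabulate-lookup T)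

pathVertices : ∀ {m} (u v : Fin m) k → List (Fin (m ℕ.+ k))
pathVertices {m} u v k = (u ↑ˡ k) ∷ map (m ↑ʳ_) (allFin k) ++ [ v ↑ˡ k ]

pathVertices-labels : ∀ {m k} (S : Subset m) (T : Subset k) u v →
  map (lookup (S ++ᵛ T)) (pathVertices u v k) ≡ pathLabels (lookup S u) T (lookup S v)
pathVertices-labels {m} {k} S T u v = cong₂ _∷_ (Vec.lookup-++ˡ S T u) (begin
    map (lookup (S ++ᵛ T)) (map (m ↑ʳ_) (allFin k) ++ [ v ↑ˡ k ])
  ≡⟨ List.map-++ _ (map (m ↑ʳ_) (allFin k)) _ ⟩
    map (lookup (S ++ᵛ T)) (map (m ↑ʳ_) (allFin k)) ++ [ lookup (S ++ᵛ T) (v ↑ˡ k) ]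
  ≡⟨ cong₂ _++_ new-labels (cong [_] (Vec.lookup-++ˡ S T v)) ⟩
    toList T ++ [ lookup S v ]
  ∎)
  where
  open ≡-Reasoning
  new-labels : map (lookup (S ++ᵛ T)) (map (m ↑ʳ_) (allFin k)) ≡ toList T
  new-labels = begin
      map (lookup (S ++ᵛ T)) (map (m ↑ʳ_) (allFin k))
    ≡⟨ sym (List.map-∘ (allFin k)) ⟩
      map (lookup (S ++ᵛ T) ∘ (m ↑ʳ_)) (allFin k)
    ≡⟨ List.map-cong (Vec.lookup-++ʳ S T) (allFin k) ⟩
      map (lookup T) (allFin k)
    ≡⟨ List.map-tabulate id (lookup T) ⟩
      tabulate (lookup T)
    ≡⟨ tabulate-lookup T ⟩
      toList T
    ∎

eCount-addPath : ∀ H u v k (S : Subset (n H)) (T : Subset k) →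
  eCount (addPath H u v k) (S ++ᵛ T) ≡ eCount H S ℕ.+ pathEdges (pathLabels (lookup S u) T (lookup S v))
eCount-addPath H u v k S T = begin
    eCount (addPath H u v k) (S ++ᵛ T)
  ≡⟨ eCount≡trues (addPath H u v k) X ⟩
    trues (map (edgeIn X) (map lift (edges H) ++ consecutive (pathVertices u v k)))
  ≡⟨ cong trues (List.map-++ (edgeIn X) (map lift (edges H)) _) ⟩
    trues (map (edgeIn X) (map lift (edges H)) ++ map (edgeIn X) (consecutive (pathVertices u v k)))
  ≡⟨ trues-++ (map (edgeIn X) (map lift (edges H))) _ ⟩
    trues (map (edgeIn X) (map lift (edges H))) ℕ.+ trues (map (edgeIn X) (consecutive (pathVertices u v k)))
  ≡⟨ cong₂ ℕ._+_ (cong trues old-edges) (cong trues new-edges) ⟩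
    trues (map (edgeIn S) (edges H)) ℕ.+ pathEdges (pathLabels (lookup S u) T (lookup S v))
  ≡⟨ cong (ℕ._+ pathEdges (pathLabels (lookup S u) T (lookup S v))) (sym (eCount≡trues H S)) ⟩
    eCount H S ℕ.+ pathEdges (pathLabels (lookup S u) T (lookup S v))
  ∎
  where
  open ≡-Reasoning
  X = S ++ᵛ T
  lift : Fin (n H) × Fin (n H) → Fin (n H ℕ.+ k) × Fin (n H ℕ.+ k)
  lift e = (proj₁ e ↑ˡ k) , (proj₂ e ↑ˡ k)
  old-edges : map (edgeIn X) (map lift (edges H)) ≡ map (edgeIn S) (edges H)
  old-edges = trans (sym (List.map-∘ (edges H)))
    (List.map-cong (λ e → cong₂ _∧_ (Vec.lookup-++ˡ S T (proj₁ e)) (Vec.lookup-++ˡ S T (proj₂ e))) (edges H))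
  new-edges : map (edgeIn X) (consecutive (pathVertices u v k))
            ≡ map (uncurry _∧_) (consecutive (pathLabels (lookup S u) T (lookup S v)))
  new-edges = trans (map-edgeIn-consecutive X (pathVertices u v k))
                    (cong (map (uncurry _∧_) ∘ consecutive) (pathVertices-labels S T u v))

-- Each induced path edge is charged to its end in T, except when the whole path is induced.
pathEdges-cases : ∀ a {k} (T : Subset k) b →
  pathEdges (pathLabels a T b) ≤ ∣ T ∣
  ⊎ (a ≡ true × b ≡ true × ∣ T ∣ ≡ k × pathEdges (pathLabels a T b) ≡ suc k)
pathEdges-cases true  []          true  = inj₂ (refl , refl , refl , refl)
pathEdges-cases true  []          false = inj₁ z≤n
pathEdges-cases false []          b     = inj₁ z≤n
pathEdges-cases a     (false ∷ T) b     with pathEdges-cases false T b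
... | inj₂ (() , _)
... | inj₁ p≤t       = inj₁ (subst (_≤ ∣ T ∣) (before-false a) p≤t)
  where
  before-false : ∀ a → pathEdges (pathLabels false T b) ≡ pathEdges (pathLabels a (false ∷ T) b)
  before-false true  = refl
  before-false false = refl
pathEdges-cases a     (true ∷ T)  b     with pathEdges-cases true T b | a
... | inj₁ p≤t                    | true  = inj₁ (s≤s p≤t)
... | inj₁ p≤t                    | false = inj₁ (ℕ.m≤n⇒m≤1+n p≤t)
... | inj₂ (_ , b≡t , t≡k , p≡k+1) | true  = inj₂ (refl , b≡t , cong suc t≡k , cong suc p≡k+1)
... | inj₂ (_ , b≡t , t≡k , p≡k+1) | false = inj₁ (ℕ.≤-reflexive (trans p≡k+1 (cong suc (sym t≡k))))

∣++∣ : ∀ {m k} (S : Subset m) (T : Subset k) → ∣ S ++ᵛ T ∣ ≡ ∣ S ∣ ℕ.+ ∣ T ∣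
∣++∣ []          T = refl
∣++∣ (true ∷ S)  T = cong suc (∣++∣ S T)
∣++∣ (false ∷ S) T = ∣++∣ S T

pathρ : ∀ {k} → Bool → Subset k → Bool → ℤ
pathρ a T b = + 9 * + ∣ T ∣ - + 7 * + pathEdges (pathLabels a T b)

ρ-addPath : ∀ H u v k (S : Subset (n H)) (T : Subset k) →
  ρ (addPath H u v k) (S ++ᵛ T) ≡ ρ H S + pathρ (lookup S u) T (lookup S v)
ρ-addPath H u v k S T = begin
    + 9 * + ∣ S ++ᵛ T ∣ - + 7 * + eCount (addPath H u v k) (S ++ᵛ T)
  ≡⟨ cong₂ (λ s e → + 9 * s - + 7 * e) (cong +_ (∣++∣ S T)) (cong +_ (eCount-addPath H u v k S T)) ⟩
    + 9 * + (∣ S ∣ ℕ.+ ∣ T ∣) - + 7 * + (eCount H S ℕ.+ p)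
  ≡⟨ cong₂ (λ s e → + 9 * s - + 7 * e) (ℤ.pos-+ ∣ S ∣ ∣ T ∣) (ℤ.pos-+ (eCount H S) p) ⟩
    + 9 * (+ ∣ S ∣ + + ∣ T ∣) - + 7 * (+ eCount H S + + p)
  ≡⟨ regroup (+ ∣ S ∣) (+ ∣ T ∣) (+ eCount H S) (+ p) ⟩
    (+ 9 * + ∣ S ∣ - + 7 * + eCount H S) + (+ 9 * + ∣ T ∣ - + 7 * + p)
  ∎
  where
  open ≡-Reasoning
  p = pathEdges (pathLabels (lookup S u) T (lookup S v))
  regroup : ∀ s t e p → + 9 * (s + t) - + 7 * (e + p) ≡ (+ 9 * s - + 7 * e) + (+ 9 * t - + 7 * p)
  regroup = solve-∀

pathρ-⊥≤0 : ∀ a k b → pathρ a (⊥ {k}) b ≤ℤ 0ℤ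
pathρ-⊥≤0 a k b = begin
    + 9 * + ∣ ⊥ {k} ∣ - + 7 * + p
  ≡⟨ cong₂ (λ t q → + 9 * + t - q) (Subset.∣⊥∣≡0 k) (sym (ℤ.pos-* 7 p)) ⟩
    0ℤ - + (7 ℕ.* p)
  ≤⟨ ℤ.i-j≤i 0ℤ (+ (7 ℕ.* p)) ⟩
    0ℤ
  ∎
  where
  open ℤ.≤-Reasoning
  p = pathEdges (pathLabels a (⊥ {k}) b)

pathρ-cases : ∀ a {k} (T : Subset k) b →
  0ℤ ≤ℤ pathρ a T b ⊎ (a ≡ true × b ≡ true × pathρ a T b ≡ + (2 *ℕ k) - + 7)
pathρ-cases a {k} T b with pathEdges-cases a T b
... | inj₁ p≤t = inj₁ (ℤ.i≤j⇒0≤j-i (subst₂ _≤ℤ_ (ℤ.pos-* 7 p) (ℤ.pos-* 9 ∣ T ∣) (+≤+ (ℕ.*-mono-≤ 7≤9 p≤t))))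
  where
  p = pathEdges (pathLabels a T b)
  7≤9 : 7 ≤ 9
  7≤9 = ℕ.m≤n+m 7 2
... | inj₂ (a≡true , b≡true , t≡k , p≡k+1) = inj₂ (a≡true , b≡true , (begin
    pathρ a T b
  ≡⟨ cong₂ (λ t p → + 9 * + t - + 7 * p) t≡k (trans (cong +_ p≡k+1) (ℤ.pos-+ 1 k)) ⟩
    + 9 * + k - + 7 * (+ 1 + + k)
  ≡⟨ whole-path (+ k) ⟩
    + 2 * + k - + 7
  ≡⟨ cong (_- + 7) (sym (ℤ.pos-* 2 k)) ⟩
    + (2 *ℕ k) - + 7
  ∎))
  where
  open ≡-Reasoning
  whole-path : ∀ x → + 9 * x - + 7 * (+ 1 + x) ≡ + 2 * x - + 7
  whole-path = solve-∀

ρ-liftSub-≤ : ∀ H u v k (S : Subset (n H)) → ρ (addPath H u v k) (liftSub k S) ≤ℤ ρ H S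
ρ-liftSub-≤ H u v k S = begin
    ρ (addPath H u v k) (S ++ᵛ ⊥)
  ≡⟨ ρ-addPath H u v k S ⊥ ⟩
    ρ H S + pathρ (lookup S u) (⊥ {k}) (lookup S v)
  ≤⟨ ℤ.+-monoʳ-≤ (ρ H S) (pathρ-⊥≤0 (lookup S u) k (lookup S v)) ⟩
    ρ H S + 0ℤ
  ≡⟨ ℤ.+-identityʳ (ρ H S) ⟩
    ρ H S
  ∎
  where open ℤ.≤-Reasoning

ρ-addPath-cases : ∀ H u v k (S : Subset (n H)) (T : Subset k) →
  ρ H S ≤ℤ ρ (addPath H u v k) (S ++ᵛ T)
  ⊎ (u ∈ S × v ∈ S × ρ H S ≡ ρ (addPath H u v k) (S ++ᵛ T) + (+ 7 - + (2 *ℕ k)))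
ρ-addPath-cases H u v k S T with pathρ-cases (lookup S u) T (lookup S v)
... | inj₁ 0≤δ = inj₁ (subst (ρ H S ≤ℤ_) (sym (ρ-addPath H u v k S T)) (ℤ.i≤i+j (ρ H S) _ {{ℤ.nonNegative 0≤δ}}))
... | inj₂ (u∈S , v∈S , δ≡) = inj₂ (Vec.lookup⇒[]= u S u∈S , Vec.lookup⇒[]= v S v∈S , (begin
    ρ H S
  ≡⟨ shift (ρ H S) (+ (2 *ℕ k)) (+ 7) ⟩
    (ρ H S + (+ (2 *ℕ k) - + 7)) + (+ 7 - + (2 *ℕ k))
  ≡⟨ cong (_+ (+ 7 - + (2 *ℕ k))) (sym (trans (ρ-addPath H u v k S T) (cong (_+_ (ρ H S)) δ≡))) ⟩
    ρ (addPath H u v k) (S ++ᵛ T) + (+ 7 - + (2 *ℕ k))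
  ∎))
  where
  open ≡-Reasoning
  shift : ∀ x a b → x ≡ (x + (a - b)) + (b - a)
  shift = solve-∀

ρ*-addPath-≤ : ∀ H u v k A → ρ* (addPath H u v k) (liftSub k A) ≤ℤ ρ* H A
ρ*-addPath-≤ H u v k A with ρ*-attained H A
... | S , A⊆S , ρ*≡ρS = begin
    ρ* (addPath H u v k) (liftSub k A)
  ≤⟨ ρ*≤ρ (addPath H u v k) (++-mono-⊆ A⊆S id) ⟩
    ρ (addPath H u v k) (liftSub k S)
  ≤⟨ ρ-liftSub-≤ H u v k S ⟩
    ρ H S
  ≡⟨ sym ρ*≡ρS ⟩
    ρ* H A
  ∎
  where open ℤ.≤-Reasoning

lemma2 : (H : Graph) (u v : Fin (n H)) (k : ℕ) → k ≤ 3
    → Simple H → u ≢ v → (k ≡ 0 → ¬ Adjacent H u v)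
    → (A : Subset (n H))
    → (ρ* H A ≡ ρ* (addPath H u v k) (liftSub k A))
      ⊎ ((ρ* (addPath H u v k) (liftSub k A) ≤ℤ ρ* H A)
        × (ρ* H A ≤ℤ ρ* H (A ∪ (⁅ u ⁆ ∪ ⁅ v ⁆)))
        × (ρ* H (A ∪ (⁅ u ⁆ ∪ ⁅ v ⁆)) ≤ℤ ρ* (addPath H u v k) (liftSub k A) + (+ 7 - + (2 *ℕ k))))
lemma2 H u v k _ _ _ _ A with ρ*-attained (addPath H u v k) (liftSub k A)
... | S′ , A⊆S′ , ρ*≡ρS′ with splitAt (n H) S′
... | S , T , refl with ρ-addPath-cases H u v k S T
... | inj₁ ρS≤ρ′ = inj₁ (ℤ.≤-antisym
        (ℤ.≤-trans (ρ*≤ρ H {S = S} (++-⊆⁻ˡ A⊆S′)) (subst (ρ H S ≤ℤ_) (sym ρ*≡ρS′) ρS≤ρ′))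
        (ρ*-addPath-≤ H u v k A))
... | inj₂ (u∈S , v∈S , ρS≡) =
  inj₂ (ρ*-addPath-≤ H u v k A , ρ*-mono H (Subset.p⊆p∪q _) , (begin
    ρ* H (A ∪ (⁅ u ⁆ ∪ ⁅ v ⁆))
  ≤⟨ ρ*≤ρ H {S = S} (∪-least (++-⊆⁻ˡ A⊆S′) (∪-least (x∈p⇒⁅x⁆⊆p u∈S) (x∈p⇒⁅x⁆⊆p v∈S))) ⟩
    ρ H S
  ≡⟨ trans ρS≡ (cong (_+ (+ 7 - + (2 *ℕ k))) (sym ρ*≡ρS′)) ⟩
    ρ* (addPath H u v k) (liftSub k A) + (+ 7 - + (2 *ℕ k))
  ∎))
  where open ℤ.≤-Reasoning
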